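{- Let $r$ and $s$ be positive integers, both odd. Then there exist sets $S$ of integers with lower density $\frac{rs}{(r+s)(r+2s)}$ and upper density $\frac{s}{r+s}$ that can be permuted to avoid $(r,s)$ $3$-progressions.
   Context: For a set $S\subseteq\mathbb{Z}$, the lower density is $\liminf_{n\to\infty}\frac{|S\cap[-n,n]|}{2n}$ and the upper density is $\limsup_{n\to\infty}\frac{|S\cap[-n,n]|}{2n}$. An $(r,s)$ $3$-progression is a sequence $a, a+rd, a+rd+sd$ of integers with $d\neq0$. A permutation of $S$ is a sequence $p_1,p_2,\dots$ in which every element of $S$ appears exactly once. It contains an $(r,s)$ $3$-progression if there are indices $i_1<i_2<i_3$ such that $p_{i_1},p_{i_2},p_{i_3}$ is one. $S$ can be permuted to avoid $(r,s)$ $3$-progressions if some permutation of $S$ contains none. -}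

module Defs where

open import Data.Nat using (ℕ; zero; suc; _*_; _≥_; _<_)
import Data.Nat as N
open import Data.Integer as Z using (ℤ; +_; -[1+_])
open import Data.Rational as Q using (ℚ; 0ℚ)
open import Data.Bool using (Bool; true; false; if_then_else_)
open import Data.Product using (Σ; ∃; ∃-syntax; _×_)
open import Relation.Nullary using (¬_)
open import Relation.Binary.PropositionalEquality using (_≡_; _≢_)

Set-ℤ : Set
Set-ℤ = ℤ → Bool

_∈S_ : ℤ → Set-ℤ → Set
z ∈S S = S z ≡ true

b2n : Bool → ℕ
b2n true  = 1
b2n false = 0

-- |S ∩ [-n, n]|
countIn : Set-ℤ → ℕ → ℕ
countIn S zero    = b2n (S (+ 0))
countIn S (suc n) = countIn S n N.+ b2n (S (+ suc n)) N.+ b2n (S -[1+ n ])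

-- the ratio |S ∩ [-n,n]| / 2n, indexed from n = 1 (the n-th term is at n+1)
ratio : Set-ℤ → ℕ → ℚ
ratio S n = (+ countIn S (suc n)) Q./ (2 * suc n)

LimInfIs : (ℕ → ℚ) → ℚ → Set
LimInfIs a L =
  (∀ (ε : ℚ) → 0ℚ Q.< ε → ∃[ N ] (∀ n → n ≥ N → L Q.- ε Q.< a n)) ×
  (∀ (ε : ℚ) → 0ℚ Q.< ε → ∀ N → ∃[ n ] (n ≥ N × a n Q.< L Q.+ ε))

LimSupIs : (ℕ → ℚ) → ℚ → Set
LimSupIs a U =
  (∀ (ε : ℚ) → 0ℚ Q.< ε → ∃[ N ] (∀ n → n ≥ N → a n Q.< U Q.+ ε)) ×
  (∀ (ε : ℚ) → 0ℚ Q.< ε → ∀ N → ∃[ n ] (n ≥ N × U Q.- ε Q.< a n))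

LowerDensity : Set-ℤ → ℚ → Set
LowerDensity S L = LimInfIs (ratio S) L

UpperDensity : Set-ℤ → ℚ → Set
UpperDensity S U = LimSupIs (ratio S) U

IsPermutationOf : (ℕ → ℤ) → Set-ℤ → Set
IsPermutationOf p S =
  (∀ i → p i ∈S S) ×
  (∀ i j → p i ≡ p j → i ≡ j) ×
  (∀ z → z ∈S S → ∃[ i ] (p i ≡ z))

Is3Prog : ℕ → ℕ → ℤ → ℤ → ℤ → Set
Is3Prog r s x y w = ∃[ d ] (d ≢ + 0 × y ≡ x Z.+ (+ r) Z.* d × w ≡ x Z.+ (+ r) Z.* d Z.+ (+ s) Z.* d)

ContainsProg : ℕ → ℕ → (ℕ → ℤ) → Set
ContainsProg r s p = ∃[ i ] ∃[ j ] ∃[ k ] (i < j × j < k × Is3Prog r s (p i) (p j) (p k))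

PermutableAvoiding : ℕ → ℕ → Set-ℤ → Set
PermutableAvoiding r s S = ∃[ p ] (IsPermutationOf p S × ¬ ContainsProg r s p)

module Submission where

-- The set S is symmetric, and its positive part is a union of blocks
-- [A k, B k] separated by gaps (B k, F k] with F k ≈ (c/r)·B k, c = r+2s.
-- The blocks are sized so that |S ∩ [1, B k]| ≈ (s/t)·B k, t = r+s: the
-- density ratio peaks at s/t at block ends and dips to rs/(tc) at gap ends.
--
-- S is enumerated block by block; within a block, the window [−B k, B k] is
-- listed in bit-reversal order (evens first, recursively), which contains no
-- (r,s)-progression because r and s are odd.  A progression spreading over
-- several blocks is impossible because the gap ratio c/r makes its last term
-- (or its last two terms) too large.

open import Data.Nat as N using (ℕ; zero; suc; _+_; _*_; _∸_; _^_; _≤_; _<_; _≥_; s≤s; z≤n; NonZero)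
open import Data.Nat.Properties
open import Data.Nat.DivMod using (m/n*n≤m; m≡m%n+[m/n]*n; m%n<n)
open import Data.Integer as Z using (ℤ; -[1+_])
import Data.Integer.Properties as ZP
import Data.Integer.Solver as ℤ-Solver
import Data.Nat.Solver as ℕ-Solver
open import Data.Rational as Q using (ℚ; 0ℚ; mkℚ; _/_)
import Data.Rational.Properties as QP
import Data.Rational.Unnormalised as U
import Data.Rational.Unnormalised.Properties as UP
open import Data.List using (List; []; _∷_; map; _++_; length)
open import Data.List.Properties using (length-map; length-++)
open import Data.Bool using (Bool; true; false; if_then_else_)
open import Function using (_∘_)
open import Data.Product using (∃-syntax; _×_; _,_; proj₁; proj₂)
open import Data.Sum using (_⊎_; inj₁; inj₂)
open import Data.Empty using (⊥-elim)
open import Relation.Nullary using (¬_; Dec; yes; no; does)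
open import Relation.Nullary.Decidable using (_×-dec_; dec-true; dec-false)
open import Relation.Binary using (tri<; tri≈; tri>)
open import Relation.Binary.PropositionalEquality
open import Defs

stepwise-mono : ∀ (f : ℕ → ℕ) → (∀ k → f k ≤ f (suc k)) → ∀ {j k} → j ≤ k → f j ≤ f k
stepwise-mono f step {j} {zero}  z≤n = ≤-refl
stepwise-mono f step {j} {suc k} j≤k with m≤n⇒m<n∨m≡n j≤k
... | inj₁ j<1+k = ≤-trans (stepwise-mono f step (≤-pred j<1+k)) (step k)
... | inj₂ refl  = ≤-refl

increasing⇒index< : ∀ (f : ℕ → ℕ) → 0 < f 0 → (∀ k → f k < f (suc k)) → ∀ k → k < f k
increasing⇒index< f f0>0 inc zero    = f0>0
increasing⇒index< f f0>0 inc (suc k) = ≤-<-trans (increasing⇒index< f f0>0 inc k) (inc k)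

from-does : ∀ {A : Set} (A? : Dec A) → does A? ≡ true → A
from-does (yes a) _ = a

module RationalBounds where

  open Z using (+_)

  cancel-+ʳ-< : ∀ (X P A Y : ℤ) → X Z.+ P ≡ A → A Z.< Y Z.+ P → X Z.< Y
  cancel-+ʳ-< X P A Y e lt =
    subst₂ Z._<_ (plus-minus X) (plus-minus Y) (ZP.+-monoˡ-< (Z.- P) (subst (Z._< Y Z.+ P) (sym e) lt))
    where
    open ℤ-Solver.+-*-Solver
    plus-minus : ∀ x → x Z.+ P Z.- P ≡ x
    plus-minus x = solve 2 (λ x p → x :+ p :- p := x) refl x P

  fraction-toℚᵘ : ∀ u v → Q.toℚᵘ ((+ u) / suc v) U.≃ U.mkℚᵘ (+ u) v
  fraction-toℚᵘ u v = QP.toℚᵘ-fromℚᵘ (U.mkℚᵘ (+ u) v)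

  pos-*-pos : ∀ m n → (+ m) Z.* (+ n) ≡ + (m * n)
  pos-*-pos m n = sym (ZP.pos-* m n)

  -- u/v − k/d < q/n, in cross-multiplied form (denominators are v+1, d+1, n+1).
  minus-below : ∀ u v k d q n →
    u * suc d * suc n < q * (suc v * suc d) + suc k * suc v * suc n →
    U.mkℚᵘ (+ u) v U.+ U.mkℚᵘ -[1+ k ] d U.< U.mkℚᵘ (+ q) n
  minus-below u v k d q n h = U.*<* (cancel-+ʳ-< X P A Y split (subst₂ Z._<_ (sym eA) (sym eYP) (Z.+<+ h)))
    where
    X P A Y : ℤ
    X = ((+ u) Z.* + suc d Z.+ -[1+ k ] Z.* + suc v) Z.* + suc n
    P = + suc k Z.* + suc v Z.* + suc n
    A = + u Z.* + suc d Z.* + suc n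
    Y = + q Z.* + (suc v * suc d)
    split : X Z.+ P ≡ A
    split = solve 5 (λ u d k v n → (u :* d :+ (:- k) :* v) :* n :+ k :* v :* n := u :* d :* n)
              refl (+ u) (+ suc d) (+ suc k) (+ suc v) (+ suc n)
      where open ℤ-Solver.+-*-Solver
    eA : A ≡ + (u * suc d * suc n)
    eA = trans (cong (Z._* + suc n) (pos-*-pos u (suc d))) (pos-*-pos (u * suc d) (suc n))
    eYP : Y Z.+ P ≡ + (q * (suc v * suc d) + suc k * suc v * suc n)
    eYP = trans (cong₂ Z._+_ (pos-*-pos q (suc v * suc d))
                  (trans (cong (Z._* + suc n) (pos-*-pos (suc k) (suc v))) (pos-*-pos (suc k * suc v) (suc n))))
                (sym (ZP.pos-+ (q * (suc v * suc d)) (suc k * suc v * suc n)))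

  below-plus : ∀ u v k d q n →
    q * (suc v * suc d) < (u * suc d + suc k * suc v) * suc n →
    U.mkℚᵘ (+ q) n U.< U.mkℚᵘ (+ u) v U.+ U.mkℚᵘ (+ suc k) d
  below-plus u v k d q n h = U.*<* (subst₂ Z._<_ (sym (pos-*-pos q (suc v * suc d))) (sym e) (Z.+<+ h))
    where
    e : ((+ u) Z.* + suc d Z.+ + suc k Z.* + suc v) Z.* + suc n ≡ + ((u * suc d + suc k * suc v) * suc n)
    e = trans (cong (Z._* + suc n) (trans (cong₂ Z._+_ (pos-*-pos u (suc d)) (pos-*-pos (suc k) (suc v)))
                                           (sym (ZP.pos-+ (u * suc d) (suc k * suc v)))))
              (pos-*-pos (u * suc d + suc k * suc v) (suc n))

  n≤kVn : ∀ n k V → 1 ≤ k → 1 ≤ V → n ≤ k * V * n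
  n≤kVn n k V k≥1 V≥1 = ≤-trans (≤-reflexive (sym (*-identityˡ n))) (*-monoˡ-≤ n (*-mono-≤ k≥1 V≥1))

  lower-cross : ∀ u V q E D n k → u * n ≤ V * q + E → suc (E * D) ≤ n → 1 ≤ k → 1 ≤ V →
    u * D * n < q * (V * D) + k * V * n
  lower-cross u V q E D n k h large k≥1 V≥1 = begin-strict
    u * D * n                 ≡⟨ solve 3 (λ u d n → u :* d :* n := (u :* n) :* d) refl u D n ⟩
    (u * n) * D               ≤⟨ *-monoˡ-≤ D h ⟩
    (V * q + E) * D           ≡⟨ solve 4 (λ v q e d → (v :* q :+ e) :* d := q :* (v :* d) :+ e :* d) refl V q E D ⟩
    q * (V * D) + E * D       <⟨ +-monoʳ-< (q * (V * D)) large ⟩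
    q * (V * D) + n           ≤⟨ +-monoʳ-≤ (q * (V * D)) (n≤kVn n k V k≥1 V≥1) ⟩
    q * (V * D) + k * V * n   ∎
    where open ≤-Reasoning
          open ℕ-Solver.+-*-Solver

  upper-cross : ∀ u V q E D n k → V * q ≤ u * n + E → suc (E * D) ≤ n → 1 ≤ k → 1 ≤ V →
    q * (V * D) < (u * D + k * V) * n
  upper-cross u V q E D n k h large k≥1 V≥1 = begin-strict
    q * (V * D)               ≡⟨ solve 3 (λ q v d → q :* (v :* d) := (v :* q) :* d) refl q V D ⟩
    (V * q) * D               ≤⟨ *-monoˡ-≤ D h ⟩
    (u * n + E) * D           ≡⟨ solve 4 (λ u n e d → (u :* n :+ e) :* d := u :* d :* n :+ e :* d) refl u n E D ⟩
    u * D * n + E * D         <⟨ +-monoʳ-< (u * D * n) large ⟩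
    u * D * n + n             ≤⟨ +-monoʳ-≤ (u * D * n) (n≤kVn n k V k≥1 V≥1) ⟩
    u * D * n + k * V * n     ≡⟨ solve 5 (λ u d n k v → u :* d :* n :+ k :* v :* n := (u :* d :+ k :* v) :* n) refl u D n k V ⟩
    (u * D + k * V) * n       ∎
    where open ≤-Reasoning
          open ℕ-Solver.+-*-Solver

  -- Beyond this index an error of E/n is smaller than ε (whose unnormalised
  -- denominator is denominator-1 + 1).
  threshold : ℕ → ℚ → ℕ
  threshold E ε = suc (E * suc (ℚ.denominator-1 ε))

  eventually-above : ∀ u v E .{{_ : NonZero v}} (ε : ℚ) → 0ℚ Q.< ε →
    ∀ q n .{{_ : NonZero n}} → threshold E ε ≤ n → u * n ≤ v * q + E → ((+ u) / v) Q.- ε Q.< (+ q) / n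
  eventually-above u (suc v) E (mkℚ (+ zero) d _) (Q.*<* (Z.+<+ ()))
  eventually-above u (suc v) E (mkℚ -[1+ k ] d _) (Q.*<* ())
  eventually-above u (suc v) E ε@(mkℚ (+ suc k) d _) _ q (suc n) large h = QP.toℚᵘ-cancel-<
    (UP.<-respʳ-≃ (UP.≃-sym (fraction-toℚᵘ q n))
      (UP.<-respˡ-≃ (UP.≃-sym lhs)
        (minus-below u v k d q n (lower-cross u (suc v) q E (suc d) (suc n) (suc k) h large (s≤s z≤n) (s≤s z≤n)))))
    where
    lhs : Q.toℚᵘ (((+ u) / suc v) Q.- ε) U.≃ U.mkℚᵘ (+ u) v U.+ U.mkℚᵘ -[1+ k ] d
    lhs = UP.≃-trans (QP.toℚᵘ-homo-+ ((+ u) / suc v) (Q.- ε)) (UP.+-cong (fraction-toℚᵘ u v) (QP.toℚᵘ-homo‿- ε))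

  eventually-below : ∀ u v E .{{_ : NonZero v}} (ε : ℚ) → 0ℚ Q.< ε →
    ∀ q n .{{_ : NonZero n}} → threshold E ε ≤ n → v * q ≤ u * n + E → (+ q) / n Q.< ((+ u) / v) Q.+ ε
  eventually-below u (suc v) E (mkℚ (+ zero) d _) (Q.*<* (Z.+<+ ()))
  eventually-below u (suc v) E (mkℚ -[1+ k ] d _) (Q.*<* ())
  eventually-below u (suc v) E ε@(mkℚ (+ suc k) d _) _ q (suc n) large h = QP.toℚᵘ-cancel-<
    (UP.<-respˡ-≃ (UP.≃-sym (fraction-toℚᵘ q n))
      (UP.<-respʳ-≃ (UP.≃-sym rhs)
        (below-plus u v k d q n (upper-cross u (suc v) q E (suc d) (suc n) (suc k) h large (s≤s z≤n) (s≤s z≤n)))))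
    where
    rhs : Q.toℚᵘ (((+ u) / suc v) Q.+ ε) U.≃ U.mkℚᵘ (+ u) v U.+ U.mkℚᵘ (+ suc k) d
    rhs = UP.≃-trans (QP.toℚᵘ-homo-+ ((+ u) / suc v) ε) (UP.+-cong (fraction-toℚᵘ u v) UP.≃-refl)

-- When p and q are odd, a (p,q)-progression in either
-- direction has ends of equal parity, so it lies within the even part or the
-- odd part, and halving it gives a progression one level down; hence the list
-- contains no such progression in list order.
module BitReversal where

  open ℕ-Solver.+-*-Solver

  -- List indexing with default 0.
  nth : List ℕ → ℕ → ℕ
  nth []       _       = 0
  nth (x ∷ xs) zero    = x
  nth (x ∷ xs) (suc i) = nth xs i

  nth-map : ∀ (f : ℕ → ℕ) xs i → i < length xs → nth (map f xs) i ≡ f (nth xs i)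
  nth-map f (x ∷ xs) zero    _       = refl
  nth-map f (x ∷ xs) (suc i) (s≤s h) = nth-map f xs i h

  nth-++ˡ : ∀ xs ys i → i < length xs → nth (xs ++ ys) i ≡ nth xs i
  nth-++ˡ (x ∷ xs) ys zero    _       = refl
  nth-++ˡ (x ∷ xs) ys (suc i) (s≤s h) = nth-++ˡ xs ys i h

  nth-++ʳ : ∀ xs ys i → nth (xs ++ ys) (length xs + i) ≡ nth ys i
  nth-++ʳ []       ys i = refl
  nth-++ʳ (x ∷ xs) ys i = nth-++ʳ xs ys i

  double odd : ℕ → ℕ
  double n = 2 * n
  odd n = suc (2 * n)

  bitOrder : ℕ → (ℕ → Bool) → List ℕ
  bitOrder zero    P = if P 0 then 0 ∷ [] else []
  bitOrder (suc m) P = map double (bitOrder m (P ∘ double)) ++ map odd (bitOrder m (P ∘ odd))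

  Evens Odds : ℕ → (ℕ → Bool) → List ℕ
  Evens m P = bitOrder m (P ∘ double)
  Odds  m P = bitOrder m (P ∘ odd)

  bitOrder-length : ∀ m P → length (bitOrder (suc m) P) ≡ length (Evens m P) + length (Odds m P)
  bitOrder-length m P =
    trans (length-++ (map double (Evens m P)))
          (cong₂ _+_ (length-map double (Evens m P)) (length-map odd (Odds m P)))

  nth-odd-part : ∀ m P i → i < length (Odds m P) →
    nth (bitOrder (suc m) P) (length (Evens m P) + i) ≡ odd (nth (Odds m P) i)
  nth-odd-part m P i h = begin
    nth (map double E ++ map odd O) (length E + i)
      ≡⟨ cong (λ l → nth (map double E ++ map odd O) (l + i)) (sym (length-map double E)) ⟩
    nth (map double E ++ map odd O) (length (map double E) + i)
      ≡⟨ nth-++ʳ (map double E) (map odd O) i ⟩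
    nth (map odd O) i
      ≡⟨ nth-map odd O i h ⟩
    odd (nth O i) ∎
    where open ≡-Reasoning
          E O : List ℕ
          E = Evens m P
          O = Odds m P

  nth-even-part : ∀ m P i → i < length (Evens m P) →
    nth (bitOrder (suc m) P) i ≡ double (nth (Evens m P) i)
  nth-even-part m P i h =
    trans (nth-++ˡ (map double E) (map odd (Odds m P)) i (subst (i <_) (sym (length-map double E)) h))
          (nth-map double E i h)
    where E : List ℕ
          E = Evens m P

  data Position (m : ℕ) (P : ℕ → Bool) (i : ℕ) : Set where
    even-part : i < length (Evens m P) →
                nth (bitOrder (suc m) P) i ≡ double (nth (Evens m P) i) → Position m P i
    odd-part  : ∀ i' → i ≡ length (Evens m P) + i' → i' < length (Odds m P) →
                nth (bitOrder (suc m) P) i ≡ odd (nth (Odds m P) i') → Position m P i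

  position : ∀ m P i → i < length (bitOrder (suc m) P) → Position m P i
  position m P i h with i <? length (Evens m P)
  ... | yes lt  = even-part lt (nth-even-part m P i lt)
  ... | no  nlt = odd-part i' (sym i≡) i'< (trans (cong (nth (bitOrder (suc m) P)) (sym i≡)) (nth-odd-part m P i' i'<))
    where
    i' : ℕ
    i' = i ∸ length (Evens m P)
    i≡ : length (Evens m P) + i' ≡ i
    i≡ = m+[n∸m]≡n (≮⇒≥ nlt)
    i'< : i' < length (Odds m P)
    i'< = +-cancelˡ-< (length (Evens m P)) i' (length (Odds m P))
            (subst (_< length (Evens m P) + length (Odds m P)) (sym i≡) (subst (i <_) (bitOrder-length m P) h))

  bitOrder-sound : ∀ m P i → i < length (bitOrder m P) → P (nth (bitOrder m P) i) ≡ true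
  bitOrder-sound zero P i h with P 0 in P0
  bitOrder-sound zero P zero    h       | true = P0
  bitOrder-sound zero P (suc i) (s≤s ()) | true
  bitOrder-sound zero P i       ()       | false
  bitOrder-sound (suc m) P i h with position m P i h
  ... | even-part lt eq       rewrite eq = bitOrder-sound m (P ∘ double) i lt
  ... | odd-part i' _ lt eq   rewrite eq = bitOrder-sound m (P ∘ odd) i' lt

  parity : ∀ z → (∃[ q ] z ≡ double q) ⊎ (∃[ q ] z ≡ odd q)
  parity zero = inj₁ (0 , refl)
  parity (suc z) with parity z
  ... | inj₁ (q , e) = inj₂ (q , cong suc e)
  ... | inj₂ (q , e) = inj₁ (suc q , trans (cong suc e) (sym (cong suc (+-suc q (q + 0)))))

  n<2^n : ∀ n → n < 2 ^ n
  n<2^n zero    = s≤s z≤n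
  n<2^n (suc n) = subst (suc (suc n) ≤_) (cong (2 ^ n +_) (sym (+-identityʳ (2 ^ n))))
                    (+-mono-≤ (≤-trans (s≤s z≤n) (n<2^n n)) (n<2^n n))

  bitOrder-complete : ∀ m P z → z < 2 ^ m → P z ≡ true →
    ∃[ i ] (i < length (bitOrder m P) × nth (bitOrder m P) i ≡ z)
  bitOrder-complete zero P zero h Pz rewrite Pz = 0 , s≤s z≤n , refl
  bitOrder-complete zero P (suc z) (s≤s ()) Pz
  bitOrder-complete (suc m) P z h Pz with parity z
  ... | inj₁ (q , refl) with bitOrder-complete m (P ∘ double) q (*-cancelˡ-< 2 q (2 ^ m) h) Pz
  ...   | i , lt , eq =
          i , ≤-trans lt (≤-trans (m≤m+n _ _) (≤-reflexive (sym (bitOrder-length m P)))) ,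
          trans (nth-even-part m P i lt) (cong double eq)
  bitOrder-complete (suc m) P z h Pz | inj₂ (q , refl)
    with bitOrder-complete m (P ∘ odd) q (*-cancelˡ-< 2 q (2 ^ m) (≤-trans (n≤1+n _) h)) Pz
  ...   | i , lt , eq =
          length (Evens m P) + i ,
          subst (length (Evens m P) + i <_) (sym (bitOrder-length m P)) (+-monoʳ-< (length (Evens m P)) lt) ,
          trans (nth-odd-part m P i lt) (cong odd eq)

  double-injective : ∀ {x y} → double x ≡ double y → x ≡ y
  double-injective {x} {y} = *-cancelˡ-≡ x y 2

  bitOrder-injective : ∀ m P i j → i < length (bitOrder m P) → j < length (bitOrder m P) →
    nth (bitOrder m P) i ≡ nth (bitOrder m P) j → i ≡ j
  bitOrder-injective zero P i j hi hj e with P 0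
  bitOrder-injective zero P zero    zero    hi       hj       e | true = refl
  bitOrder-injective zero P zero    (suc j) hi       (s≤s ()) e | true
  bitOrder-injective zero P (suc i) j       (s≤s ()) hj       e | true
  bitOrder-injective zero P i       j       ()       hj       e | false
  bitOrder-injective (suc m) P i j hi hj e with position m P i hi | position m P j hj
  ... | even-part li ei | even-part lj ej =
        bitOrder-injective m (P ∘ double) i j li lj (double-injective (trans (sym ei) (trans e ej)))
  ... | even-part li ei | odd-part j' _ lj ej =
        ⊥-elim (even≢odd (nth (Evens m P) i) (nth (Odds m P) j') (trans (sym ei) (trans e ej)))
  ... | odd-part i' _ li ei | even-part lj ej =
        ⊥-elim (even≢odd (nth (Evens m P) j) (nth (Odds m P) i') (sym (trans (sym ei) (trans e ej))))
  ... | odd-part i' i≡ li ei | odd-part j' j≡ lj ej =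
        trans i≡ (trans (cong (_+_ (length (Evens m P)))
          (bitOrder-injective m (P ∘ odd) i' j' li lj (double-injective (suc-injective (trans (sym ei) (trans e ej))))))
          (sym j≡))

  Ascending : ℕ → ℕ → ℕ → ℕ → ℕ → Set
  Ascending p q X Y W = ∃[ d ] (Y ≡ X + p * suc d × W ≡ Y + q * suc d)

  -- A (p,q)-progression among naturals with nonzero difference of either sign.
  ℕProgression : ℕ → ℕ → ℕ → ℕ → ℕ → Set
  ℕProgression p q X Y W = Ascending p q X Y W ⊎ Ascending q p W Y X

  ℕProgression-≡ : ∀ p q {X Y W X' Y' W'} → X ≡ X' → Y ≡ Y' → W ≡ W' →
    ℕProgression p q X Y W → ℕProgression p q X' Y' W'
  ℕProgression-≡ p q refl refl refl prog = prog

  -- For odd p, q: 2X, 2Y, 2W ascending forces an even difference, so X, Y, W is ascending.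
  halve : ∀ a b x y w d → 2 * y ≡ 2 * x + odd a * suc d → 2 * w ≡ 2 * y + odd b * suc d →
    Ascending (odd a) (odd b) x y w
  halve a b x y w d h₁ h₂ with parity (suc d)
  ... | inj₁ (zero , ())
  ... | inj₁ (suc e , d≡) = e , cancel2 x y (odd a) h₁ , cancel2 y w (odd b) h₂
    where
    cancel2 : ∀ u v p → 2 * v ≡ 2 * u + p * suc d → v ≡ u + p * suc e
    cancel2 u v p h = *-cancelˡ-≡ v (u + p * suc e) 2 (trans h (trans (cong (λ z → 2 * u + p * z) d≡)
      (solve 3 (λ u p e → con 2 :* u :+ p :* (con 2 :* e) := con 2 :* (u :+ p :* e)) refl u p (suc e))))
  ... | inj₂ (e , d≡) = ⊥-elim (even≢odd y (x + e + a * suc (2 * e)) (trans h₁ (trans (cong (λ z → 2 * x + odd a * z) d≡)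
        (solve 3 (λ x a e → con 2 :* x :+ (con 1 :+ con 2 :* a) :* (con 1 :+ con 2 :* e)
                             := con 1 :+ con 2 :* (x :+ e :+ a :* (con 1 :+ con 2 :* e))) refl x a e))))

  halve-evens : ∀ a b {x y w} → ℕProgression (odd a) (odd b) (double x) (double y) (double w) →
    ℕProgression (odd a) (odd b) x y w
  halve-evens a b {x} {y} {w} (inj₁ (d , h₁ , h₂)) = inj₁ (halve a b x y w d h₁ h₂)
  halve-evens a b {x} {y} {w} (inj₂ (d , h₁ , h₂)) = inj₂ (halve b a w y x d h₁ h₂)

  halve-odds : ∀ a b {x y w} → ℕProgression (odd a) (odd b) (odd x) (odd y) (odd w) →
    ℕProgression (odd a) (odd b) x y w
  halve-odds a b {x} {y} {w} (inj₁ (d , h₁ , h₂)) = inj₁ (halve a b x y w d (suc-injective h₁) (suc-injective h₂))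
  halve-odds a b {x} {y} {w} (inj₂ (d , h₁ , h₂)) = inj₂ (halve b a w y x d (suc-injective h₁) (suc-injective h₂))

  -- The ends of an ascending (p,q)-progression with p, q odd differ by (p+q)·d, an even number.
  ends-differ-evenly : ∀ a b {X Y W} → Ascending (odd a) (odd b) X Y W → ∃[ K ] W ≡ X + 2 * K
  ends-differ-evenly a b {X} {Y} {W} (d , h₁ , h₂) = suc (a + b) * suc d ,
    trans h₂ (trans (cong (_+ odd b * suc d) h₁)
      (solve 4 (λ x a b d → x :+ (con 1 :+ con 2 :* a) :* d :+ (con 1 :+ con 2 :* b) :* d
                            := x :+ con 2 :* ((con 1 :+ a :+ b) :* d)) refl X a b (suc d)))

  even-ends-odd : ∀ a b {x Y w} → ¬ ℕProgression (odd a) (odd b) (double x) Y (odd w)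
  even-ends-odd a b {x} {Y} {w} (inj₁ asc) with ends-differ-evenly a b asc
  ... | K , e = even≢odd (x + K) w (trans (*-distribˡ-+ 2 x K) (sym e))
  even-ends-odd a b {x} {Y} {w} (inj₂ asc) with ends-differ-evenly b a asc
  ... | K , e = even≢odd x (w + K) (trans e (cong suc (sym (*-distribˡ-+ 2 w K))))

  -- A list with fewer than three entries contains no progression; the base level has at most one.
  bitOrder-zero-short : ∀ P → length (bitOrder 0 P) ≤ 1
  bitOrder-zero-short P with P 0
  ... | true  = ≤-refl
  ... | false = z≤n

  bitOrder-avoids : ∀ a b m P i j l → i < j → j < l → l < length (bitOrder m P) →
    ¬ ℕProgression (odd a) (odd b) (nth (bitOrder m P) i) (nth (bitOrder m P) j) (nth (bitOrder m P) l)
  bitOrder-avoids a b zero P i j l i<j j<l l< _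
    with ≤-trans (≤-trans (s≤s (≤-trans (s≤s i<j) j<l)) l<) (bitOrder-zero-short P)
  ... | s≤s ()
  bitOrder-avoids a b (suc m) P i j l i<j j<l l< prog
    with position m P i (<-trans i<j (<-trans j<l l<)) | position m P j (<-trans j<l l<) | position m P l l<
  ... | even-part _ ei | _ | odd-part l' _ _ el =
        even-ends-odd a b {nth (Evens m P) i} {_} {nth (Odds m P) l'} (ℕProgression-≡ (odd a) (odd b) ei refl el prog)
  ... | odd-part i' i≡ _ _ | _ | even-part ll _ =
        <-irrefl refl (<-trans ll (≤-<-trans (≤-trans (m≤m+n _ i') (≤-reflexive (sym i≡))) (<-trans i<j j<l)))
  ... | even-part _ _ | odd-part j' j≡ _ _ | even-part ll _ =
        <-irrefl refl (<-trans ll (≤-<-trans (≤-trans (m≤m+n _ j') (≤-reflexive (sym j≡))) j<l))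
  ... | odd-part i' i≡ _ _ | even-part lj _ | odd-part _ _ _ _ =
        <-irrefl refl (<-trans lj (≤-<-trans (≤-trans (m≤m+n _ i') (≤-reflexive (sym i≡))) i<j))
  ... | even-part _ ei | even-part _ ej | even-part ll el =
        bitOrder-avoids a b m (P ∘ double) i j l i<j j<l ll
          (halve-evens a b (ℕProgression-≡ (odd a) (odd b) ei ej el prog))
  ... | odd-part i' i≡ _ ei | odd-part j' j≡ _ ej | odd-part l' l≡ ll el =
        bitOrder-avoids a b m (P ∘ odd) i' j' l'
          (+-cancelˡ-< (length (Evens m P)) i' j' (subst₂ _<_ i≡ j≡ i<j))
          (+-cancelˡ-< (length (Evens m P)) j' l' (subst₂ _<_ j≡ l≡ j<l))
          ll (halve-odds a b (ℕProgression-≡ (odd a) (odd b) ei ej el prog))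

-- With r = 2a+1, s = 2b+1, t = r+s, c = r+2s, the positive part of
-- S is a union of blocks [A k, B k] separated by gaps (B k, F k] where
-- F k = ⌊c·B k / r⌋ and A (k+1) = F k + 1.  The block ends are chosen so that
-- the count P k of positive elements up to B k satisfies t·P k ≈ s·B k: the
-- density at B k tends to s/t, and at F k (after a gap of ratio c/r) to
-- rs/(tc).  The ratio c/r is also exactly what keeps progressions from
-- jumping between blocks.
module Blocks (a b : ℕ) where

  open ℕ-Solver.+-*-Solver
  open ≤-Reasoning

  r s t c : ℕ
  r = suc (2 * a)
  s = suc (2 * b)
  t = r + s
  c = r + 2 * s

  s≥1 : 1 ≤ s
  s≥1 = s≤s z≤n

  r*⌊x/r⌋≤x : ∀ x → r * (x N./ r) ≤ x
  r*⌊x/r⌋≤x x = subst (_≤ x) (*-comm (x N./ r) r) (m/n*n≤m x r)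

  x<r*⌊x/r⌋+r : ∀ x → x < r * (x N./ r) + r
  x<r*⌊x/r⌋+r x = begin-strict
    x                     ≡⟨ m≡m%n+[m/n]*n x r ⟩
    x N.% r + x N./ r * r <⟨ +-monoˡ-< (x N./ r * r) (m%n<n x r) ⟩
    r + x N./ r * r       ≡⟨ solve 2 (λ r q → r :+ q :* r := r :* q :+ r) refl r (x N./ r) ⟩
    r * (x N./ r) + r     ∎

  -- B k: end of block k;  P k: number of positive elements of S up to B k;
  -- F k: end of the gap after block k.  Block k+1 has B (k+1) − F k elements,
  -- with B (k+1) chosen so that r·B (k+1) ≈ t·(F k − P k), i.e. t·P (k+1) ≈ s·B (k+1).
  mutual
    Bk : ℕ → ℕ
    Bk zero    = t * (2 * r)
    Bk (suc k) = (t * (Fk k ∸ Pk k)) N./ r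

    Pk : ℕ → ℕ
    Pk zero    = s * (2 * r)
    Pk (suc k) = Pk k + (Bk (suc k) ∸ Fk k)

    Fk : ℕ → ℕ
    Fk k = (c * Bk k) N./ r

  Ak : ℕ → ℕ
  Ak zero    = suc (r * (2 * r))
  Ak (suc k) = suc (Fk k)

  Pbefore : ℕ → ℕ
  Pbefore zero    = 0
  Pbefore (suc k) = Pk k

  -- The invariant of the construction: P k is the best approximation from
  -- below to (s/t)·B k, and the blocks are large compared with r.
  record Invariant (k : ℕ) : Set where
    field
      count-below : t * Pk k ≤ s * Bk k
      count-above : s * Bk k < t * Pk k + r
      large       : 2 * r * r ≤ Bk k

  module Step (k : ℕ) (inv : Invariant k) where
    open Invariant inv
    B P F G B' : ℕ
    B = Bk k
    P = Pk k
    F = Fk k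
    G = F ∸ P
    B' = Bk (suc k)

    rF≤cB : r * F ≤ c * B
    rF≤cB = r*⌊x/r⌋≤x (c * B)

    cB<rF+r : c * B < r * F + r
    cB<rF+r = x<r*⌊x/r⌋+r (c * B)

    B+2r<F : B + 2 * r < F
    B+2r<F = *-cancelˡ-< r (B + 2 * r) F (+-cancelʳ-< r (r * (B + 2 * r)) (r * F) (begin-strict
      r * (B + 2 * r) + r     ≡⟨ solve 3 (λ r B x → r :* (B :+ x) :+ r := r :* B :+ (x :* r :+ r)) refl r B (2 * r) ⟩
      r * B + (2 * r * r + r) ≤⟨ +-monoʳ-≤ (r * B) 2r²+r≤2sB ⟩
      r * B + 2 * s * B       ≡⟨ sym (*-distribʳ-+ B r (2 * s)) ⟩
      c * B                   <⟨ cB<rF+r ⟩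
      r * F + r               ∎))
      where
      2r²+r≤2sB : 2 * r * r + r ≤ 2 * s * B
      2r²+r≤2sB = begin
        2 * r * r + r         ≤⟨ +-monoʳ-≤ (2 * r * r) (m≤n*m r (2 * r)) ⟩
        2 * r * r + 2 * r * r ≡⟨ cong (2 * r * r +_) (sym (+-identityʳ (2 * r * r))) ⟩
        2 * (2 * r * r)       ≤⟨ *-monoʳ-≤ 2 large ⟩
        2 * B                 ≤⟨ *-monoˡ-≤ B (*-monoʳ-≤ 2 s≥1) ⟩
        2 * s * B             ∎

    B<F : B < F
    B<F = ≤-<-trans (m≤m+n B (2 * r)) B+2r<F

    P+G≡F : P + G ≡ F
    P+G≡F = m+[n∸m]≡n (≤-trans (*-cancelˡ-≤ t (≤-trans count-below (*-monoˡ-≤ B (m≤n+m s r)))) (<⇒≤ B<F))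

    rB'≤tG : r * B' ≤ t * G
    rB'≤tG = r*⌊x/r⌋≤x (t * G)

    tG<rB'+r : t * G < r * B' + r
    tG<rB'+r = x<r*⌊x/r⌋+r (t * G)

    rF+2r≤tG : r * F + 2 * r ≤ t * G
    rF+2r≤tG = +-cancelʳ-≤ (s * B) (r * F + 2 * r) (t * G) (begin
      r * F + 2 * r + s * B         ≡⟨ solve 3 (λ x y z → x :+ y :+ z := x :+ (z :+ y)) refl (r * F) (2 * r) (s * B) ⟩
      r * F + (s * B + 2 * r)       ≤⟨ +-monoʳ-≤ (r * F) (+-monoʳ-≤ (s * B) (m≤n*m (2 * r) s)) ⟩
      r * F + (s * B + s * (2 * r)) ≡⟨ cong (r * F +_) (sym (*-distribˡ-+ s B (2 * r))) ⟩
      r * F + s * (B + 2 * r)       ≤⟨ +-monoʳ-≤ (r * F) (*-monoʳ-≤ s (<⇒≤ B+2r<F)) ⟩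
      r * F + s * F                 ≡⟨ sym (*-distribʳ-+ F r s) ⟩
      t * F                         ≡⟨ cong (t *_) (sym P+G≡F) ⟩
      t * (P + G)                   ≡⟨ *-distribˡ-+ t P G ⟩
      t * P + t * G                 ≤⟨ +-monoˡ-≤ (t * G) count-below ⟩
      s * B + t * G                 ≡⟨ +-comm (s * B) (t * G) ⟩
      t * G + s * B                 ∎)

    A'<B' : suc F < B'
    A'<B' = *-cancelˡ-< r (suc F) B' (+-cancelʳ-< r (r * suc F) (r * B') (begin-strict
      r * suc F + r ≡⟨ solve 2 (λ r F → r :* (con 1 :+ F) :+ r := r :* F :+ con 2 :* r) refl r F ⟩
      r * F + 2 * r ≤⟨ rF+2r≤tG ⟩
      t * G         <⟨ tG<rB'+r ⟩
      r * B' + r    ∎))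

    F<B' : F < B'
    F<B' = ≤-trans (n≤1+n (suc F)) A'<B'

    X : ℕ
    X = B' ∸ F
    F+X≡B' : F + X ≡ B'
    F+X≡B' = m+[n∸m]≡n (<⇒≤ F<B')

    count-split : t * (P + X) + t * G ≡ r * B' + s * B'
    count-split = begin-equality
      t * (P + X) + t * G ≡⟨ solve 4 (λ t p x g → t :* (p :+ x) :+ t :* g := t :* ((p :+ g) :+ x)) refl t P X G ⟩
      t * ((P + G) + X)   ≡⟨ cong (λ z → t * (z + X)) P+G≡F ⟩
      t * (F + X)         ≡⟨ cong (t *_) F+X≡B' ⟩
      t * B'              ≡⟨ *-distribʳ-+ B' r s ⟩
      r * B' + s * B'     ∎

    invariant' : Invariant (suc k)
    invariant' = record
      { count-below = +-cancelʳ-≤ (t * G) (t * (P + X)) (s * B') (begin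
          t * (P + X) + t * G ≡⟨ count-split ⟩
          r * B' + s * B'     ≤⟨ +-monoˡ-≤ (s * B') rB'≤tG ⟩
          t * G + s * B'      ≡⟨ +-comm (t * G) (s * B') ⟩
          s * B' + t * G      ∎)
      ; count-above = +-cancelʳ-< (t * G) (s * B') (t * (P + X) + r) (begin-strict
          s * B' + t * G             <⟨ +-monoʳ-< (s * B') tG<rB'+r ⟩
          s * B' + (r * B' + r)      ≡⟨ solve 3 (λ x y z → x :+ (y :+ z) := (y :+ x) :+ z) refl (s * B') (r * B') r ⟩
          (r * B' + s * B') + r      ≡⟨ cong (_+ r) (sym count-split) ⟩
          (t * (P + X) + t * G) + r  ≡⟨ solve 3 (λ x y z → (x :+ y) :+ z := (x :+ z) :+ y) refl (t * (P + X)) (t * G) r ⟩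
          (t * (P + X) + r) + t * G  ∎)
      ; large = ≤-trans large (<⇒≤ (<-trans B<F F<B'))
      }

    -- Growth inequalities that keep progressions inside a block (see Enumeration).
    cB<rA' : c * B < r * suc F
    cB<rA' = begin-strict
      c * B     <⟨ cB<rF+r ⟩
      r * F + r ≡⟨ +-comm (r * F) r ⟩
      r + r * F ≡⟨ sym (*-suc r F) ⟩
      r * suc F ∎

    rB'+sB<tA' : r * B' + s * B < t * suc F
    rB'+sB<tA' = begin-strict
      r * B' + s * B      ≤⟨ +-monoˡ-≤ (s * B) rB'≤tG ⟩
      t * G + s * B       <⟨ +-monoʳ-< (t * G) count-above ⟩
      t * G + (t * P + r) ≤⟨ +-monoʳ-≤ (t * G) (+-monoʳ-≤ (t * P) (m≤m+n r s)) ⟩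
      t * G + (t * P + t) ≡⟨ solve 3 (λ t g p → t :* g :+ (t :* p :+ t) := t :* (p :+ g) :+ t) refl t G P ⟩
      t * (P + G) + t     ≡⟨ cong (λ z → t * z + t) P+G≡F ⟩
      t * F + t           ≡⟨ solve 2 (λ t f → t :* f :+ t := t :* (con 1 :+ f)) refl t F ⟩
      t * suc F           ∎

  invariant : ∀ k → Invariant k
  invariant zero = record
    { count-below = ≤-reflexive tP≡sB
    ; count-above = subst (_< t * (s * (2 * r)) + r) tP≡sB (m<m+n (t * (s * (2 * r))) (s≤s z≤n))
    ; large       = ≤-trans (≤-reflexive (*-comm (2 * r) r)) (*-monoˡ-≤ (2 * r) (m≤m+n r s))
    }
    where
    tP≡sB : t * (s * (2 * r)) ≡ s * (t * (2 * r))
    tP≡sB = solve 3 (λ t s x → t :* (s :* x) := s :* (t :* x)) refl t s (2 * r)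
  invariant (suc k) = Step.invariant' k (invariant k)

  A≤B : ∀ k → Ak k ≤ Bk k
  A≤B zero = begin
    suc (r * (2 * r))         ≤⟨ +-monoˡ-≤ (r * (2 * r)) (s≤s z≤n) ⟩
    s * (2 * r) + r * (2 * r) ≡⟨ +-comm (s * (2 * r)) (r * (2 * r)) ⟩
    r * (2 * r) + s * (2 * r) ≡⟨ sym (*-distribʳ-+ (2 * r) r s) ⟩
    t * (2 * r)               ∎
  A≤B (suc k) = <⇒≤ (Step.A'<B' k (invariant k))

  B<F : ∀ k → Bk k < Fk k
  B<F k = Step.B<F k (invariant k)

  B<A-next : ∀ k → Bk k < Ak (suc k)
  B<A-next k = <-trans (B<F k) (n<1+n (Fk k))

  A-increasing : ∀ k → Ak k < Ak (suc k)
  A-increasing k = ≤-<-trans (A≤B k) (B<A-next k)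

  B-increasing : ∀ k → Bk k < Bk (suc k)
  B-increasing k = <-≤-trans (B<A-next k) (A≤B (suc k))

  A-mono : ∀ {j k} → j ≤ k → Ak j ≤ Ak k
  A-mono = stepwise-mono Ak (λ k → <⇒≤ (A-increasing k))

  B-mono : ∀ {j k} → j ≤ k → Bk j ≤ Bk k
  B-mono = stepwise-mono Bk (λ k → <⇒≤ (B-increasing k))

  B<A : ∀ {j k} → j < k → Bk j < Ak k
  B<A {j} {suc k} j<k = <-≤-trans (B<A-next j) (A-mono j<k)

  k<A : ∀ k → k < Ak k
  k<A = increasing⇒index< Ak (s≤s z≤n) A-increasing

  k<B : ∀ k → k < Bk k
  k<B k = <-≤-trans (k<A k) (A≤B k)

  Pk≡ : ∀ k → Pk k ≡ Pbefore k + (suc (Bk k) ∸ Ak k)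
  Pk≡ zero = sym (begin-equality
    t * (2 * r) ∸ r * (2 * r)               ≡⟨ cong (_∸ r * (2 * r)) (*-distribʳ-+ (2 * r) r s) ⟩
    r * (2 * r) + s * (2 * r) ∸ r * (2 * r) ≡⟨ m+n∸m≡n (r * (2 * r)) (s * (2 * r)) ⟩
    s * (2 * r)                             ∎)
  Pk≡ (suc k) = refl

module Counting (a b : ℕ) where

  open Blocks a b
  open ℕ-Solver.+-*-Solver
  open ≤-Reasoning

  InBlock : ℕ → ℕ → Set
  InBlock n k = Ak k ≤ n × n ≤ Bk k

  inBlock? : ∀ n k → Dec (InBlock n k)
  inBlock? n k = Ak k ≤? n ×-dec n ≤? Bk k

  -- A block containing n has index k < A k ≤ n, so membership is a bounded search.
  inSomeBlock? : ∀ n → Dec (∃[ k ] (k < suc n × InBlock n k))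
  inSomeBlock? n = anyUpTo? (inBlock? n) (suc n)

  member : ℕ → Bool
  member n = does (inSomeBlock? n)

  member-intro : ∀ {n k} → InBlock n k → member n ≡ true
  member-intro {n} {k} ib = dec-true (inSomeBlock? n) (k , s≤s (<⇒≤ (<-≤-trans (k<A k) (proj₁ ib))) , ib)

  member-elim : ∀ {n} → member n ≡ true → ∃[ k ] InBlock n k
  member-elim {n} h = let (k , _ , ib) = from-does (inSomeBlock? n) h in k , ib

  member-false : ∀ {n} → (∀ k → ¬ InBlock n k) → member n ≡ false
  member-false {n} out = dec-false (inSomeBlock? n) (λ (k , _ , ib) → out k ib)

  below-first : ∀ {n} → n < Ak 0 → ∀ k → ¬ InBlock n k
  below-first n<A₀ k (A≤n , _) = <-irrefl refl (<-≤-trans n<A₀ (≤-trans (A-mono z≤n) A≤n))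

  in-gap-only : ∀ {n j} → Bk j < n → n < Ak (suc j) → ∀ k → ¬ InBlock n k
  in-gap-only {n} {j} B<n n<A k (A≤n , n≤B) with <-cmp k j
  ... | tri< k<j _ _ = <-irrefl refl (≤-<-trans (≤-trans n≤B (B-mono (<⇒≤ k<j))) B<n)
  ... | tri≈ _ refl _ = <-irrefl refl (≤-<-trans n≤B B<n)
  ... | tri> _ _ j<k = <-irrefl refl (<-≤-trans n<A (≤-trans (A-mono j<k) A≤n))

  block-unique : ∀ {n j k} → InBlock n j → InBlock n k → j ≡ k
  block-unique {n} {j} {k} (Aj≤n , n≤Bj) (Ak≤n , n≤Bk) with <-cmp j k
  ... | tri< j<k _ _ = ⊥-elim (<-irrefl refl (<-≤-trans (B<A j<k) (≤-trans Ak≤n n≤Bj)))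
  ... | tri≈ _ j≡k _ = j≡k
  ... | tri> _ _ k<j = ⊥-elim (<-irrefl refl (<-≤-trans (B<A k<j) (≤-trans Aj≤n n≤Bk)))

  S : Set-ℤ
  S (Z.+ n)      = member n
  S (Z.-[1+ n ]) = member (suc n)

  S-abs : ∀ z → S z ≡ member Z.∣ z ∣
  S-abs (Z.+ n)      = refl
  S-abs (Z.-[1+ n ]) = refl

  Q : ℕ → ℕ
  Q zero    = 0
  Q (suc n) = Q n + b2n (member (suc n))

  -- By symmetry |S ∩ [−n, n]| = 2·Q n (and 0 ∉ S).
  countIn≡2Q : ∀ n → countIn S n ≡ 2 * Q n
  countIn≡2Q zero rewrite member-false (below-first {0} (s≤s z≤n)) = refl
  countIn≡2Q (suc n) rewrite countIn≡2Q n =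
    solve 2 (λ q x → con 2 :* q :+ x :+ x := con 2 :* (q :+ x)) refl (Q n) (b2n (member (suc n)))

  Q-step-in : ∀ {n k} → InBlock (suc n) k → Q (suc n) ≡ Q n + 1
  Q-step-in ib rewrite member-intro ib = refl

  Q-step-out : ∀ {n} → (∀ k → ¬ InBlock (suc n) k) → Q (suc n) ≡ Q n
  Q-step-out {n} out rewrite member-false out = +-identityʳ (Q n)

  data Region (n : ℕ) : Set where
    before-first : n < Ak 0 → Q n ≡ 0 → Region n
    in-block     : ∀ k → InBlock n k → Q n ≡ Pbefore k + (suc n ∸ Ak k) → Region n
    in-gap       : ∀ k → Bk k < n → n < Ak (suc k) → Q n ≡ Pk k → Region n

  enter-block : ∀ n k → suc n ≡ Ak k → Q n ≡ Pbefore k → Region (suc n)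
  enter-block n k n+1≡A Qn≡ = in-block k ib (begin-equality
      Q (suc n)                          ≡⟨ Q-step-in ib ⟩
      Q n + 1                            ≡⟨ cong (_+ 1) Qn≡ ⟩
      Pbefore k + 1                      ≡⟨ cong (Pbefore k +_) (sym (m+n∸n≡m 1 (suc n))) ⟩
      Pbefore k + (suc (suc n) ∸ suc n)  ≡⟨ cong (λ z → Pbefore k + (suc (suc n) ∸ z)) n+1≡A ⟩
      Pbefore k + (suc (suc n) ∸ Ak k)   ∎)
    where
    ib : InBlock (suc n) k
    ib = ≤-reflexive (sym n+1≡A) , subst (_≤ Bk k) (sym n+1≡A) (A≤B k)

  continue-block : ∀ n k → Ak k ≤ n → n < Bk k → Q n ≡ Pbefore k + (suc n ∸ Ak k) → Region (suc n)
  continue-block n k A≤n n<B Qn≡ = in-block k ib (begin-equality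
      Q (suc n)                              ≡⟨ Q-step-in ib ⟩
      Q n + 1                                ≡⟨ cong (_+ 1) Qn≡ ⟩
      Pbefore k + (suc n ∸ Ak k) + 1         ≡⟨ solve 2 (λ x y → x :+ y :+ con 1 := x :+ (con 1 :+ y)) refl (Pbefore k) (suc n ∸ Ak k) ⟩
      Pbefore k + (1 + (suc n ∸ Ak k))       ≡⟨ cong (Pbefore k +_) (sym (+-∸-assoc 1 (≤-trans A≤n (n≤1+n n)))) ⟩
      Pbefore k + (suc (suc n) ∸ Ak k)       ∎)
    where
    ib : InBlock (suc n) k
    ib = ≤-trans A≤n (n≤1+n n) , n<B

  region : ∀ n → Region n
  region zero = before-first (s≤s z≤n) refl
  region (suc n) with region n
  ... | before-first n<A₀ Qn≡0 with m≤n⇒m<n∨m≡n n<A₀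
  ...   | inj₁ n+1<A₀ = before-first n+1<A₀ (trans (Q-step-out (below-first n+1<A₀)) Qn≡0)
  ...   | inj₂ n+1≡A₀ = enter-block n 0 n+1≡A₀ Qn≡0
  region (suc n) | in-block k (A≤n , n≤B) Qn≡ with m≤n⇒m<n∨m≡n n≤B
  ...   | inj₁ n<B = continue-block n k A≤n n<B Qn≡
  ...   | inj₂ refl with m≤n⇒m<n∨m≡n (B<A-next k)
  ...     | inj₁ n+1<A = in-gap k ≤-refl n+1<A (trans (Q-step-out (in-gap-only {j = k} ≤-refl n+1<A)) (trans Qn≡ (sym (Pk≡ k))))
  ...     | inj₂ n+1≡A = enter-block n (suc k) n+1≡A (trans Qn≡ (sym (Pk≡ k)))
  region (suc n) | in-gap k B<n n<A Qn≡ with m≤n⇒m<n∨m≡n n<A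
  ...   | inj₁ n+1<A = in-gap k (<-trans B<n (n<1+n n)) n+1<A
                         (trans (Q-step-out (in-gap-only {j = k} (<-trans B<n (n<1+n n)) n+1<A)) Qn≡)
  ...   | inj₂ n+1≡A = enter-block n (suc k) n+1≡A Qn≡

  Q-in-block : ∀ {n k} → InBlock n k → Q n ≡ Pbefore k + (suc n ∸ Ak k)
  Q-in-block {n} {k} ib with region n
  ... | before-first n<A₀ _ = ⊥-elim (below-first n<A₀ k ib)
  ... | in-block j ib' Qn≡ with block-unique ib' ib
  ...   | refl = Qn≡
  Q-in-block {n} {k} ib | in-gap j B<n n<A _ = ⊥-elim (in-gap-only {j = j} B<n n<A k ib)

  Q-at-B : ∀ k → Q (Bk k) ≡ Pk k
  Q-at-B k = trans (Q-in-block {k = k} (A≤B k , ≤-refl)) (sym (Pk≡ k))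

  Q-at-F : ∀ k → Q (Fk k) ≡ Pk k
  Q-at-F k with region (Fk k)
  ... | before-first F<A₀ _ = ⊥-elim (<-irrefl refl (<-trans F<A₀ (≤-<-trans (≤-trans (A-mono z≤n) (A≤B k)) (B<F k))))
  ... | in-block j ib _ = ⊥-elim (in-gap-only {j = k} (B<F k) (n<1+n (Fk k)) j ib)
  ... | in-gap j B<F' F<A QF≡ with <-cmp j k
  ...   | tri< j<k _ _ = ⊥-elim (<-irrefl refl (<-trans F<A (≤-<-trans (≤-trans (A-mono j<k) (A≤B k)) (B<F k))))
  ...   | tri≈ _ refl _ = QF≡
  ...   | tri> _ _ k<j = ⊥-elim (<-irrefl refl (<-≤-trans (n<1+n (Fk k)) (≤-trans (A-mono k<j) (≤-trans (A≤B j) (<⇒≤ B<F')))))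

  Q-upper : ∀ n → t * Q n ≤ s * n
  Q-upper n with region n
  ... | before-first _ Qn≡0 rewrite Qn≡0 | *-zeroʳ t = z≤n
  ... | in-gap k B<n _ Qn≡ rewrite Qn≡ = ≤-trans (Invariant.count-below (invariant k)) (*-monoʳ-≤ s (<⇒≤ B<n))
  ... | in-block k (A≤n , n≤B) Qn≡ = +-cancelʳ-≤ (s * rest) (t * Q n) (s * n) (begin
      t * Q n + s * rest ≤⟨ +-monoʳ-≤ (t * Q n) (*-monoˡ-≤ rest (m≤n+m s r)) ⟩
      t * Q n + t * rest ≡⟨ sym (*-distribˡ-+ t (Q n) rest) ⟩
      t * (Q n + rest)   ≡⟨ cong (t *_) (sym Pk≡Qn+rest) ⟩
      t * Pk k           ≤⟨ Invariant.count-below (invariant k) ⟩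
      s * Bk k           ≡⟨ cong (s *_) (sym n+rest≡B) ⟩
      s * (n + rest)     ≡⟨ *-distribˡ-+ s n rest ⟩
      s * n + s * rest   ∎)
    where
    rest : ℕ
    rest = Bk k ∸ n
    n+rest≡B : n + rest ≡ Bk k
    n+rest≡B = m+[n∸m]≡n n≤B
    Pk≡Qn+rest : Pk k ≡ Q n + rest
    Pk≡Qn+rest = begin-equality
      Pk k                                       ≡⟨ Pk≡ k ⟩
      Pbefore k + (suc (Bk k) ∸ Ak k)            ≡⟨ cong (λ z → Pbefore k + (suc z ∸ Ak k)) (sym n+rest≡B) ⟩
      Pbefore k + (suc n + rest ∸ Ak k)          ≡⟨ cong (Pbefore k +_) (+-∸-comm rest (≤-trans A≤n (n≤1+n n))) ⟩
      Pbefore k + ((suc n ∸ Ak k) + rest)        ≡⟨ sym (+-assoc (Pbefore k) _ rest) ⟩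
      Pbefore k + (suc n ∸ Ak k) + rest          ≡⟨ cong (_+ rest) (sym Qn≡) ⟩
      Q n + rest                                 ∎

  -- At the end of a gap the count is smallest relative to n: about (rs/tc)·F k.
  rsF≤tcP : ∀ k → r * s * Fk k ≤ t * c * Pk k + c * r
  rsF≤tcP k = begin
    r * s * Fk k       ≡⟨ solve 3 (λ r s f → r :* s :* f := s :* (r :* f)) refl r s (Fk k) ⟩
    s * (r * Fk k)     ≤⟨ *-monoʳ-≤ s (Step.rF≤cB k (invariant k)) ⟩
    s * (c * Bk k)     ≡⟨ solve 3 (λ s c b → s :* (c :* b) := c :* (s :* b)) refl s c (Bk k) ⟩
    c * (s * Bk k)     ≤⟨ *-monoʳ-≤ c (<⇒≤ (Invariant.count-above (invariant k))) ⟩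
    c * (t * Pk k + r) ≡⟨ solve 4 (λ c t p r → c :* (t :* p :+ r) := t :* c :* p :+ c :* r) refl c t (Pk k) r ⟩
    t * c * Pk k + c * r ∎

  -- rs/tc < 1: inside a block Q outgrows the lower density.
  rs≤tc : r * s ≤ t * c
  rs≤tc = *-mono-≤ (m≤m+n r s) (≤-trans (m≤m+n s (s + 0)) (m≤n+m (2 * s) r))

  E : ℕ
  E = r * s * Ak 0 + c * r

  -- Inside a block the count grows by one per step, faster than (rs/tc) per step.
  Q-lower-in-block : ∀ n k → InBlock n k → Q n ≡ Pbefore k + (suc n ∸ Ak k) → r * s * n ≤ t * c * Q n + E
  Q-lower-in-block n zero (A≤n , _) Qn≡ = begin
      r * s * n                     ≤⟨ *-monoʳ-≤ (r * s) (n≤1+n n) ⟩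
      r * s * suc n                 ≡⟨ cong (r * s *_) (sym (m+[n∸m]≡n (≤-trans A≤n (n≤1+n n)))) ⟩
      r * s * (Ak 0 + d)            ≡⟨ *-distribˡ-+ (r * s) (Ak 0) d ⟩
      r * s * Ak 0 + r * s * d      ≤⟨ +-monoʳ-≤ (r * s * Ak 0) (*-monoˡ-≤ d rs≤tc) ⟩
      r * s * Ak 0 + t * c * d      ≤⟨ +-monoˡ-≤ (t * c * d) (m≤m+n (r * s * Ak 0) (c * r)) ⟩
      E + t * c * d                 ≡⟨ +-comm E (t * c * d) ⟩
      t * c * d + E                 ≡⟨ cong (λ z → t * c * z + E) (sym Qn≡) ⟩
      t * c * Q n + E               ∎
    where d : ℕ
          d = suc n ∸ Ak 0
  Q-lower-in-block n (suc k) (A≤n , _) Qn≡ = begin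
      r * s * n                         ≡⟨ cong (r * s *_) (sym F+d≡n) ⟩
      r * s * (Fk k + d)                ≡⟨ *-distribˡ-+ (r * s) (Fk k) d ⟩
      r * s * Fk k + r * s * d          ≤⟨ +-mono-≤ (rsF≤tcP k) (*-monoˡ-≤ d rs≤tc) ⟩
      t * c * Pk k + c * r + t * c * d  ≡⟨ solve 4 (λ x y z w → x :* y :+ z :+ x :* w := x :* (y :+ w) :+ z) refl (t * c) (Pk k) (c * r) d ⟩
      t * c * (Pk k + d) + c * r        ≤⟨ +-monoʳ-≤ (t * c * (Pk k + d)) (m≤n+m (c * r) (r * s * Ak 0)) ⟩
      t * c * (Pk k + d) + E            ≡⟨ cong (λ z → t * c * z + E) (sym Qn≡) ⟩
      t * c * Q n + E                   ∎
    where d : ℕ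
          d = n ∸ Fk k
          F+d≡n : Fk k + d ≡ n
          F+d≡n = m+[n∸m]≡n (≤-trans (n≤1+n (Fk k)) A≤n)

  Q-lower : ∀ n → r * s * n ≤ t * c * Q n + E
  Q-lower n with region n
  ... | before-first n<A₀ _ = ≤-trans (*-monoʳ-≤ (r * s) (<⇒≤ n<A₀)) (≤-trans (m≤m+n _ (c * r)) (m≤n+m E (t * c * Q n)))
  ... | in-block k ib Qn≡ = Q-lower-in-block n k ib Qn≡
  ... | in-gap k _ n<A Qn≡ rewrite Qn≡ = begin
      r * s * n            ≤⟨ *-monoʳ-≤ (r * s) (≤-pred n<A) ⟩
      r * s * Fk k         ≤⟨ rsF≤tcP k ⟩
      t * c * Pk k + c * r ≤⟨ +-monoʳ-≤ (t * c * Pk k) (m≤n+m (c * r) (r * s * Ak 0)) ⟩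
      t * c * Pk k + E     ∎

  -- The upper density is attained at block ends ...
  Q-at-B-large : ∀ k → s * Bk k < t * Q (Bk k) + r
  Q-at-B-large k rewrite Q-at-B k = Invariant.count-above (invariant k)

  -- ... and the lower density at gap ends.
  Q-at-F-small : ∀ k → t * c * Q (Fk k) ≤ r * s * Fk k + r * s
  Q-at-F-small k rewrite Q-at-F k = begin
    t * c * Pk k           ≡⟨ solve 3 (λ t c p → t :* c :* p := c :* (t :* p)) refl t c (Pk k) ⟩
    c * (t * Pk k)         ≤⟨ *-monoʳ-≤ c (Invariant.count-below (invariant k)) ⟩
    c * (s * Bk k)         ≡⟨ solve 3 (λ c s b → c :* (s :* b) := s :* (c :* b)) refl c s (Bk k) ⟩
    s * (c * Bk k)         ≤⟨ *-monoʳ-≤ s (<⇒≤ (Step.cB<rF+r k (invariant k))) ⟩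
    s * (r * Fk k + r)     ≡⟨ solve 3 (λ s r f → s :* (r :* f :+ r) := r :* s :* f :+ r :* s) refl s r (Fk k) ⟩
    r * s * Fk k + r * s   ∎

module Densities (a b : ℕ) where

  open Z using (+_)
  open Blocks a b
  open Counting a b
  open RationalBounds

  ratio≡ : ∀ n → ratio S n ≡ (+ (2 * Q (suc n))) / (2 * suc n)
  ratio≡ n = cong (λ z → (+ z) / (2 * suc n)) (countIn≡2Q (suc n))

  -- Doubling both sides of a linear bound (the ratio has denominator 2(n+1)).
  doubled : ∀ x y z u w → x * y ≤ z * u + w → x * (2 * y) ≤ z * (2 * u) + 2 * w
  doubled x y z u w h = begin
    x * (2 * y)           ≡⟨ solve 2 (λ x y → x :* (con 2 :* y) := con 2 :* (x :* y)) refl x y ⟩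
    2 * (x * y)           ≤⟨ *-monoʳ-≤ 2 h ⟩
    2 * (z * u + w)       ≡⟨ solve 3 (λ z u w → con 2 :* (z :* u :+ w) := z :* (con 2 :* u) :+ con 2 :* w) refl z u w ⟩
    z * (2 * u) + 2 * w   ∎
    where open ≤-Reasoning
          open ℕ-Solver.+-*-Solver

  K≤2[1+n] : ∀ {K n} → K ≤ n → K ≤ 2 * suc n
  K≤2[1+n] {K} {n} K≤n = ≤-trans K≤n (≤-trans (n≤1+n n) (m≤m+n (suc n) _))

  -- Along a sequence with k < x k: the index n with n + 1 = x (M + K) is late
  -- (n ≥ M) and its ratio has a large denominator (2(n+1) ≥ K).
  module LateIndex (x : ℕ → ℕ) (k<x : ∀ k → k < x k) (M K : ℕ) where

    late : ℕ
    late = x (M + K) ∸ 1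

    late+1≡ : suc late ≡ x (M + K)
    late+1≡ = m+[n∸m]≡n (≤-<-trans z≤n (k<x (M + K)))

    M+K<late+1 : M + K < suc late
    M+K<late+1 = subst (M + K <_) (sym late+1≡) (k<x (M + K))

    late≥M : M ≤ late
    late≥M = ≤-trans (m≤m+n M K) (≤-pred M+K<late+1)

    K≤2[late+1] : K ≤ 2 * suc late
    K≤2[late+1] = ≤-trans (m≤n+m K M) (≤-trans (<⇒≤ M+K<late+1) (m≤m+n (suc late) _))

  -- Lower density rs/(tc): Q-lower eventually, Q-at-F-small at gap ends.
  lower-density : LowerDensity S ((+ (r * s)) / (t * c))
  lower-density = eventually , infinitely-often
    where
    eventually : ∀ (ε : ℚ) → 0ℚ Q.< ε → ∃[ N ] (∀ n → n ≥ N → ((+ (r * s)) / (t * c)) Q.- ε Q.< ratio S n)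
    eventually ε ε>0 = threshold (2 * E) ε , λ n n≥K → subst (((+ (r * s)) / (t * c)) Q.- ε Q.<_) (sym (ratio≡ n))
      (eventually-above (r * s) (t * c) (2 * E) ε ε>0 (2 * Q (suc n)) (2 * suc n) (K≤2[1+n] n≥K)
        (doubled (r * s) (suc n) (t * c) (Q (suc n)) E (Q-lower (suc n))))
    infinitely-often : ∀ (ε : ℚ) → 0ℚ Q.< ε → ∀ M → ∃[ n ] (n ≥ M × ratio S n Q.< ((+ (r * s)) / (t * c)) Q.+ ε)
    infinitely-often ε ε>0 M = late , late≥M , subst (Q._< ((+ (r * s)) / (t * c)) Q.+ ε) (sym (ratio≡ late))
      (eventually-below (r * s) (t * c) (2 * (r * s)) ε ε>0 (2 * Q (suc late)) (2 * suc late) K≤2[late+1]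
        (subst (λ m → t * c * (2 * Q m) ≤ r * s * (2 * m) + 2 * (r * s)) (sym late+1≡)
          (doubled (t * c) (Q (Fk k)) (r * s) (Fk k) (r * s) (Q-at-F-small k))))
      where
      K k : ℕ
      K = threshold (2 * (r * s)) ε
      k = M + K
      open LateIndex Fk (λ k → <-trans (k<B k) (B<F k)) M K

  -- Upper density s/t: Q-upper eventually, Q-at-B-large at block ends.
  upper-density : UpperDensity S ((+ s) / t)
  upper-density = eventually , infinitely-often
    where
    eventually : ∀ (ε : ℚ) → 0ℚ Q.< ε → ∃[ N ] (∀ n → n ≥ N → ratio S n Q.< ((+ s) / t) Q.+ ε)
    eventually ε ε>0 = threshold 0 ε , λ n n≥K → subst (Q._< ((+ s) / t) Q.+ ε) (sym (ratio≡ n))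
      (eventually-below s t 0 ε ε>0 (2 * Q (suc n)) (2 * suc n) (K≤2[1+n] n≥K)
        (doubled t (Q (suc n)) s (suc n) 0 (≤-trans (Q-upper (suc n)) (m≤m+n (s * suc n) 0))))
    infinitely-often : ∀ (ε : ℚ) → 0ℚ Q.< ε → ∀ M → ∃[ n ] (n ≥ M × ((+ s) / t) Q.- ε Q.< ratio S n)
    infinitely-often ε ε>0 M = late , late≥M , subst (((+ s) / t) Q.- ε Q.<_) (sym (ratio≡ late))
      (eventually-above s t (2 * r) ε ε>0 (2 * Q (suc late)) (2 * suc late) K≤2[late+1]
        (subst (λ m → s * (2 * m) ≤ t * (2 * Q m) + 2 * r) (sym late+1≡)
          (doubled s (Bk k) t (Q (Bk k)) r (<⇒≤ (Q-at-B-large k)))))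
      where
      K k : ℕ
      K = threshold (2 * r) ε
      k = M + K
      open LateIndex Bk k<B M K

-- The enumeration of S: block after block, each block (both signs together)
-- in bit-reversal order of its shifted window [0, 2·B k].
module Enumeration (a b : ℕ) where

  open BitReversal
  open Blocks a b
  open Counting a b

  shift : ℕ → ℕ → ℤ
  shift k z = Z.+ z Z.- Z.+ Bk k

  inWindow : ℕ → ℕ → Bool
  inWindow k z = does (inBlock? Z.∣ shift k z ∣ k)

  -- 2 ^ levels k exceeds the window length 2·B k + 1.
  levels : ℕ → ℕ
  levels k = suc (2 * Bk k)

  blockList : ℕ → List ℕ
  blockList k = bitOrder (levels k) (inWindow k)

  len : ℕ → ℕ
  len k = length (blockList k)

  entry : ℕ → ℕ → ℤ
  entry k o = shift k (nth (blockList k) o)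

  entry-in-block : ∀ k o → o < len k → InBlock Z.∣ entry k o ∣ k
  entry-in-block k o o< = from-does (inBlock? _ k) (bitOrder-sound (levels k) (inWindow k) o o<)

  unshift : ℕ → ℤ → ℕ
  unshift B (Z.+ n)      = n + B
  unshift B (Z.-[1+ n ]) = B ∸ suc n

  shift-unshift : ∀ B x → Z.∣ x ∣ ≤ B → Z.+ unshift B x Z.- Z.+ B ≡ x
  shift-unshift B (Z.+ n) _ = trans (cong (Z._- Z.+ B) (ZP.pos-+ n B)) (solve 2 (λ n b → n :+ b :- b := n) refl (Z.+ n) (Z.+ B))
    where open ℤ-Solver.+-*-Solver
  shift-unshift B (Z.-[1+ n ]) n<B =
    trans (cong (Z._- Z.+ B) (trans (sym (ZP.⊖-≥ n<B)) (sym (ZP.m-n≡m⊖n B (suc n)))))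
          (solve 2 (λ b m → b :- m :- b := :- m) refl (Z.+ B) (Z.+ suc n))
    where open ℤ-Solver.+-*-Solver

  unshift≤2B : ∀ B x → Z.∣ x ∣ ≤ B → unshift B x ≤ 2 * B
  unshift≤2B B (Z.+ n) n≤B = ≤-trans (+-monoˡ-≤ B n≤B) (≤-reflexive (cong (B +_) (sym (+-identityʳ B))))
  unshift≤2B B (Z.-[1+ n ]) _ = ≤-trans (m∸n≤m B (suc n)) (m≤m+n B (B + 0))

  entry-complete : ∀ k x → InBlock Z.∣ x ∣ k → ∃[ o ] (o < len k × entry k o ≡ x)
  entry-complete k x ib with bitOrder-complete (levels k) (inWindow k) (unshift (Bk k) x)
        (<-trans (s≤s (unshift≤2B (Bk k) x (proj₂ ib))) (n<2^n (levels k)))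
        (dec-true (inBlock? _ k) (subst (λ z → InBlock Z.∣ z ∣ k) (sym (shift-unshift (Bk k) x (proj₂ ib))) ib))
  ... | o , o< , eq = o , o< , trans (cong (shift k) eq) (shift-unshift (Bk k) x (proj₂ ib))

  -- Each block has an entry (namely B k), so the enumeration keeps advancing.
  len-positive : ∀ k → 0 < len k
  len-positive k = ≤-<-trans z≤n (proj₁ (proj₂ (entry-complete k (Z.+ Bk k) (A≤B k , ≤-refl))))

  shift-injective : ∀ k {z z'} → shift k z ≡ shift k z' → z ≡ z'
  shift-injective k {z} {z'} e = ZP.+-injective (begin
      Z.+ z                  ≡⟨ solve 2 (λ z b → z := z :- b :+ b) refl (Z.+ z) (Z.+ Bk k) ⟩
      shift k z Z.+ Z.+ Bk k  ≡⟨ cong (Z._+ Z.+ Bk k) e ⟩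
      shift k z' Z.+ Z.+ Bk k ≡⟨ solve 2 (λ z b → z :- b :+ b := z) refl (Z.+ z') (Z.+ Bk k) ⟩
      Z.+ z'                 ∎)
    where open ℤ-Solver.+-*-Solver
          open ≡-Reasoning

  start : ℕ → ℕ
  start zero    = 0
  start (suc k) = start k + len k

  start-mono : ∀ {j k} → j ≤ k → start j ≤ start k
  start-mono = stepwise-mono start (λ k → m≤m+n (start k) (len k))

  blockOf : ℕ → ℕ
  blockOf zero = 0
  blockOf (suc i) with suc i <? start (suc (blockOf i))
  ... | yes _ = blockOf i
  ... | no  _ = suc (blockOf i)

  blockOf-spec : ∀ i → start (blockOf i) ≤ i × i < start (suc (blockOf i))
  blockOf-spec zero = z≤n , len-positive 0
  blockOf-spec (suc i) with suc i <? start (suc (blockOf i))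
  ... | yes i+1< = ≤-trans (proj₁ (blockOf-spec i)) (n≤1+n i) , i+1<
  ... | no  i+1≮ = ≤-reflexive (sym i+1≡) ,
                   subst (_< start (suc (blockOf i)) + len (suc (blockOf i))) (sym i+1≡)
                     (m<m+n (start (suc (blockOf i))) (len-positive (suc (blockOf i))))
    where
    i+1≡ : suc i ≡ start (suc (blockOf i))
    i+1≡ = ≤-antisym (proj₂ (blockOf-spec i)) (≮⇒≥ i+1≮)

  offset : ℕ → ℕ
  offset i = i ∸ start (blockOf i)

  index≡ : ∀ i → i ≡ start (blockOf i) + offset i
  index≡ i = sym (m+[n∸m]≡n (proj₁ (blockOf-spec i)))

  offset< : ∀ i → offset i < len (blockOf i)
  offset< i = +-cancelˡ-< (start (blockOf i)) (offset i) (len (blockOf i))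
    (subst (_< start (blockOf i) + len (blockOf i)) (index≡ i) (proj₂ (blockOf-spec i)))

  blockOf-start : ∀ k o → o < len k → blockOf (start k + o) ≡ k
  blockOf-start k o o< with <-cmp (blockOf (start k + o)) k | blockOf-spec (start k + o)
  ... | tri< j<k _ _ | _ , i< = ⊥-elim (<-irrefl refl (<-≤-trans i< (≤-trans (start-mono j<k) (m≤m+n (start k) o))))
  ... | tri≈ _ j≡k _ | _      = j≡k
  ... | tri> _ _ k<j | ≤i , _ = ⊥-elim (<-irrefl refl (<-≤-trans (+-monoʳ-< (start k) o<) (≤-trans (start-mono k<j) ≤i)))

  offset-start : ∀ k o → o < len k → offset (start k + o) ≡ o
  offset-start k o o< = trans (cong (λ j → start k + o ∸ start j) (blockOf-start k o o<)) (m+n∸m≡n (start k) o)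

  blockOf-mono : ∀ {i j} → i ≤ j → blockOf i ≤ blockOf j
  blockOf-mono {i} {j} i≤j = ≮⇒≥ (λ bj<bi → <-irrefl refl
    (<-≤-trans (proj₂ (blockOf-spec j)) (≤-trans (start-mono bj<bi) (≤-trans (proj₁ (blockOf-spec i)) i≤j))))

  offset-mono : ∀ {i j} → i < j → blockOf i ≡ blockOf j → offset i < offset j
  offset-mono {i} {j} i<j same = +-cancelˡ-< (start (blockOf j)) (offset i) (offset j)
    (subst₂ _<_ (trans (index≡ i) (cong (λ k → start k + offset i) same)) (index≡ j) i<j)

  enumeration : ℕ → ℤ
  enumeration i = entry (blockOf i) (offset i)

  enumeration-in-S : ∀ i → enumeration i ∈S S
  enumeration-in-S i = trans (S-abs (enumeration i)) (member-intro (entry-in-block (blockOf i) (offset i) (offset< i)))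

  entry-injective : ∀ k o k' o' → o < len k → o' < len k' → entry k o ≡ entry k' o' → k ≡ k' × o ≡ o'
  entry-injective k o k' o' o< o'< e
    with block-unique (entry-in-block k o o<) (subst (λ z → InBlock Z.∣ z ∣ k') (sym e) (entry-in-block k' o' o'<))
  ... | refl = refl , bitOrder-injective (levels k) (inWindow k) o o' o< o'< (shift-injective k e)

  enumeration-injective : ∀ i j → enumeration i ≡ enumeration j → i ≡ j
  enumeration-injective i j e with entry-injective (blockOf i) (offset i) (blockOf j) (offset j) (offset< i) (offset< j) e
  ... | same-block , same-offset =
        trans (index≡ i) (trans (cong₂ _+_ (cong start same-block) same-offset) (sym (index≡ j)))

  enumeration-onto : ∀ z → z ∈S S → ∃[ i ] (enumeration i ≡ z)
  enumeration-onto z z∈S with member-elim (trans (sym (S-abs z)) z∈S)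
  ... | k , ib with entry-complete k z ib
  ...   | o , o< , eq = start k + o , trans (cong₂ entry (blockOf-start k o o<) (offset-start k o o<)) eq

  Prog : ℤ → ℤ → ℤ → Set
  Prog = Is3Prog r s

  abs-scale : ∀ n x → Z.∣ Z.+ n Z.* x ∣ ≡ n * Z.∣ x ∣
  abs-scale n x = ZP.∣i*j∣≡∣i∣*∣j∣ (Z.+ n) x

  -- For a progression x, y = x + rd, w = y + sd one has r·w = t·y − s·x and t·y = r·w + s·x.
  third-bound : ∀ x y w → Prog x y w → r * Z.∣ w ∣ ≤ t * Z.∣ y ∣ + s * Z.∣ x ∣
  third-bound x y w (d , _ , y≡ , w≡) = begin
    r * Z.∣ w ∣                               ≡⟨ sym (abs-scale r w) ⟩
    Z.∣ Z.+ r Z.* w ∣                         ≡⟨ cong Z.∣_∣ rw≡ty-sx ⟩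
    Z.∣ Z.+ t Z.* y Z.- Z.+ s Z.* x ∣          ≤⟨ ZP.∣i-j∣≤∣i∣+∣j∣ (Z.+ t Z.* y) (Z.+ s Z.* x) ⟩
    Z.∣ Z.+ t Z.* y ∣ + Z.∣ Z.+ s Z.* x ∣      ≡⟨ cong₂ _+_ (abs-scale t y) (abs-scale s x) ⟩
    t * Z.∣ y ∣ + s * Z.∣ x ∣                 ∎
    where
    open ≤-Reasoning
    rw≡ty-sx : Z.+ r Z.* w ≡ Z.+ t Z.* y Z.- Z.+ s Z.* x
    rw≡ty-sx = trans (cong (Z._*_ (Z.+ r)) w≡) (trans
      (solve 4 (λ R S x d → R :* (x :+ R :* d :+ S :* d) := (R :+ S) :* (x :+ R :* d) :- S :* x) refl (Z.+ r) (Z.+ s) x d)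
      (cong₂ (λ u v → u Z.* v Z.- Z.+ s Z.* x) (sym (ZP.pos-+ r s)) (sym y≡)))
      where open ℤ-Solver.+-*-Solver

  middle-bound : ∀ x y w → Prog x y w → t * Z.∣ y ∣ ≤ r * Z.∣ w ∣ + s * Z.∣ x ∣
  middle-bound x y w (d , _ , y≡ , w≡) = begin
    t * Z.∣ y ∣                               ≡⟨ sym (abs-scale t y) ⟩
    Z.∣ Z.+ t Z.* y ∣                         ≡⟨ cong Z.∣_∣ ty≡rw+sx ⟩
    Z.∣ Z.+ r Z.* w Z.+ Z.+ s Z.* x ∣          ≤⟨ ZP.∣i+j∣≤∣i∣+∣j∣ (Z.+ r Z.* w) (Z.+ s Z.* x) ⟩
    Z.∣ Z.+ r Z.* w ∣ + Z.∣ Z.+ s Z.* x ∣      ≡⟨ cong₂ _+_ (abs-scale r w) (abs-scale s x) ⟩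
    r * Z.∣ w ∣ + s * Z.∣ x ∣                 ∎
    where
    open ≤-Reasoning
    ty≡rw+sx : Z.+ t Z.* y ≡ Z.+ r Z.* w Z.+ Z.+ s Z.* x
    ty≡rw+sx = trans (cong₂ Z._*_ (ZP.pos-+ r s) y≡) (trans
      (solve 4 (λ R S x d → (R :+ S) :* (x :+ R :* d) := R :* (x :+ R :* d :+ S :* d) :+ S :* x) refl (Z.+ r) (Z.+ s) x d)
      (cong (λ u → Z.+ r Z.* u Z.+ Z.+ s Z.* x) (sym w≡)))
      where open ℤ-Solver.+-*-Solver

  no-jump-to-later : ∀ m x y w → Z.∣ x ∣ ≤ Bk m → Z.∣ y ∣ ≤ Bk m → Ak (suc m) ≤ Z.∣ w ∣ → ¬ Prog x y w
  no-jump-to-later m x y w x≤ y≤ w≥ prog = <-irrefl refl (begin-strict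
    r * Ak (suc m)               ≤⟨ *-monoʳ-≤ r w≥ ⟩
    r * Z.∣ w ∣                  ≤⟨ third-bound x y w prog ⟩
    t * Z.∣ y ∣ + s * Z.∣ x ∣    ≤⟨ +-mono-≤ (*-monoʳ-≤ t y≤) (*-monoʳ-≤ s x≤) ⟩
    t * Bk m + s * Bk m          ≡⟨ solve 3 (λ r s B → (r :+ s) :* B :+ s :* B := (r :+ con 2 :* s) :* B) refl r s (Bk m) ⟩
    c * Bk m                     <⟨ Step.cB<rA' m (invariant m) ⟩
    r * Ak (suc m)               ∎)
    where open ≤-Reasoning
          open ℕ-Solver.+-*-Solver

  no-jump-into-later : ∀ m x y w → Z.∣ x ∣ ≤ Bk m → InBlock Z.∣ y ∣ (suc m) → InBlock Z.∣ w ∣ (suc m) → ¬ Prog x y w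
  no-jump-into-later m x y w x≤ (y≥ , _) (_ , w≤) prog = <-irrefl refl (begin-strict
    t * Ak (suc m)             ≤⟨ *-monoʳ-≤ t y≥ ⟩
    t * Z.∣ y ∣                ≤⟨ middle-bound x y w prog ⟩
    r * Z.∣ w ∣ + s * Z.∣ x ∣  ≤⟨ +-mono-≤ (*-monoʳ-≤ r w≤) (*-monoʳ-≤ s x≤) ⟩
    r * Bk (suc m) + s * Bk m  <⟨ Step.rB'+sB<tA' m (invariant m) ⟩
    t * Ak (suc m)             ∎)
    where open ≤-Reasoning

  ℕProgression-of : ∀ X Y W → Prog (Z.+ X) (Z.+ Y) (Z.+ W) → ℕProgression r s X Y W
  ℕProgression-of X Y W (Z.+ zero , d≢0 , _) = ⊥-elim (d≢0 refl)
  ℕProgression-of X Y W (Z.+ suc n , _ , y≡ , w≡) = inj₁ (n , Y≡ , trans W≡ (cong (_+ s * suc n) (sym Y≡)))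
    where
    Y≡ : Y ≡ X + r * suc n
    Y≡ = ZP.+-injective (trans y≡ (trans (cong (Z._+_ (Z.+ X)) (sym (ZP.pos-* r (suc n)))) (sym (ZP.pos-+ X (r * suc n)))))
    W≡ : W ≡ X + r * suc n + s * suc n
    W≡ = ZP.+-injective (trans w≡ (trans (cong₂ (λ u v → Z.+ X Z.+ u Z.+ v) (sym (ZP.pos-* r (suc n))) (sym (ZP.pos-* s (suc n))))
           (trans (cong (Z._+ Z.+ (s * suc n)) (sym (ZP.pos-+ X (r * suc n)))) (sym (ZP.pos-+ (X + r * suc n) (s * suc n))))))
  ℕProgression-of X Y W (Z.-[1+ n ] , _ , y≡ , w≡) = inj₂ (n , Y≡ , X≡)
    where
    open ℤ-Solver.+-*-Solver
    rd sd : ℤ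
    rd = Z.+ (r * suc n)
    sd = Z.+ (s * suc n)
    neg-scale : ∀ m → Z.+ m Z.* Z.-[1+ n ] ≡ Z.- Z.+ (m * suc n)
    neg-scale m = trans (sym (ZP.neg-distribʳ-* (Z.+ m) (Z.+ suc n))) (cong Z.-_ (sym (ZP.pos-* m (suc n))))
    X≡ : X ≡ Y + r * suc n
    X≡ = ZP.+-injective (sym (trans (ZP.pos-+ Y (r * suc n)) (trans (cong (Z._+ rd) (trans y≡ (cong (Z._+_ (Z.+ X)) (neg-scale r))))
           (solve 2 (λ x p → x :+ (:- p) :+ p := x) refl (Z.+ X) rd))))
    Y≡ : Y ≡ W + s * suc n
    Y≡ = ZP.+-injective (sym (trans (ZP.pos-+ W (s * suc n)) (trans (cong (Z._+ sd) (trans w≡ (cong (Z._+_ (Z.+ X Z.+ Z.+ r Z.* Z.-[1+ n ])) (neg-scale s))))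
           (trans (solve 3 (λ x u q → x :+ u :+ (:- q) :+ q := x :+ u) refl (Z.+ X) (Z.+ r Z.* Z.-[1+ n ]) sd) (sym y≡)))))

  translate : ∀ x y w K → Prog x y w → Prog (x Z.+ K) (y Z.+ K) (w Z.+ K)
  translate x y w K (d , d≢0 , y≡ , w≡) = d , d≢0 ,
    trans (cong (Z._+ K) y≡) (solve 4 (λ x K R d → x :+ R :* d :+ K := x :+ K :+ R :* d) refl x K (Z.+ r) d) ,
    trans (cong (Z._+ K) w≡) (solve 5 (λ x K R S d → x :+ R :* d :+ S :* d :+ K := x :+ K :+ R :* d :+ S :* d) refl x K (Z.+ r) (Z.+ s) d)
    where open ℤ-Solver.+-*-Solver

  unshift-entry : ∀ k z → shift k z Z.+ Z.+ Bk k ≡ Z.+ z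
  unshift-entry k z = solve 2 (λ z b → z :- b :+ b := z) refl (Z.+ z) (Z.+ Bk k)
    where open ℤ-Solver.+-*-Solver

  -- Within a block: translating by B k turns the progression into one among window positions.
  within-block : ∀ k o₁ o₂ o₃ → o₁ < o₂ → o₂ < o₃ → o₃ < len k → ¬ Prog (entry k o₁) (entry k o₂) (entry k o₃)
  within-block k o₁ o₂ o₃ o₁<o₂ o₂<o₃ o₃< prog =
    bitOrder-avoids a b (levels k) (inWindow k) o₁ o₂ o₃ o₁<o₂ o₂<o₃ o₃<
      (ℕProgression-of z₁ z₂ z₃ (subst₃ Prog (unshift-entry k z₁) (unshift-entry k z₂) (unshift-entry k z₃) (translate (entry k o₁) (entry k o₂) (entry k o₃) (Z.+ Bk k) prog)))
    where z₁ z₂ z₃ : ℕ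
          z₁ = nth (blockList k) o₁
          z₂ = nth (blockList k) o₂
          z₃ = nth (blockList k) o₃
          subst₃ : ∀ (R : ℤ → ℤ → ℤ → Set) {x y w x' y' w'} → x ≡ x' → y ≡ y' → w ≡ w' → R x y w → R x' y' w'
          subst₃ R refl refl refl h = h

  entries-avoid : ∀ k₁ o₁ k₂ o₂ k₃ o₃ → o₁ < len k₁ → o₂ < len k₂ → o₃ < len k₃ → k₁ ≤ k₂ → k₂ ≤ k₃ →
    (k₁ ≡ k₂ → o₁ < o₂) → (k₂ ≡ k₃ → o₂ < o₃) → ¬ Prog (entry k₁ o₁) (entry k₂ o₂) (entry k₃ o₃)
  entries-avoid k₁ o₁ k₂ o₂ k₃ o₃ h₁ h₂ h₃ k₁≤k₂ k₂≤k₃ same₁₂ same₂₃ with m≤n⇒m<n∨m≡n k₂≤k₃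
  entries-avoid k₁ o₁ k₂ o₂ (suc m) o₃ h₁ h₂ h₃ k₁≤k₂ k₂≤k₃ same₁₂ same₂₃ | inj₁ (s≤s k₂≤m) =
    no-jump-to-later m (entry k₁ o₁) (entry k₂ o₂) (entry (suc m) o₃)
      (≤-trans (proj₂ (entry-in-block k₁ o₁ h₁)) (B-mono (≤-trans k₁≤k₂ k₂≤m)))
      (≤-trans (proj₂ (entry-in-block k₂ o₂ h₂)) (B-mono k₂≤m))
      (proj₁ (entry-in-block (suc m) o₃ h₃))
  ... | inj₂ refl with m≤n⇒m<n∨m≡n k₁≤k₂
  entries-avoid k₁ o₁ (suc m) o₂ .(suc m) o₃ h₁ h₂ h₃ k₁≤k₂ k₂≤k₃ same₁₂ same₂₃ | inj₂ refl | inj₁ (s≤s k₁≤m) =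
    no-jump-into-later m (entry k₁ o₁) (entry (suc m) o₂) (entry (suc m) o₃)
      (≤-trans (proj₂ (entry-in-block k₁ o₁ h₁)) (B-mono k₁≤m))
      (entry-in-block (suc m) o₂ h₂) (entry-in-block (suc m) o₃ h₃)
  ... | inj₂ refl = within-block k₁ o₁ o₂ o₃ (same₁₂ refl) (same₂₃ refl) h₃

  enumeration-avoids : ¬ ContainsProg r s enumeration
  enumeration-avoids (i , j , l , i<j , j<l , prog) =
    entries-avoid (blockOf i) (offset i) (blockOf j) (offset j) (blockOf l) (offset l) (offset< i) (offset< j) (offset< l)
      (blockOf-mono (<⇒≤ i<j)) (blockOf-mono (<⇒≤ j<l)) (offset-mono i<j) (offset-mono j<l) prog

  permutable-avoiding : PermutableAvoiding r s S
  permutable-avoiding = enumeration , (enumeration-in-S , enumeration-injective , enumeration-onto) , enumeration-avoids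

open import Data.Integer using (+_)

mainTheorem12 : ∀ (a b : ℕ) →
    ∃[ S ] (LowerDensity S ((+ (suc (2 * a) * suc (2 * b)))
                              / ((suc (2 * a) + suc (2 * b)) * (suc (2 * a) + 2 * suc (2 * b))))
          × UpperDensity S ((+ suc (2 * b)) / (suc (2 * a) + suc (2 * b)))
          × PermutableAvoiding (suc (2 * a)) (suc (2 * b)) S)
mainTheorem12 a b = S , lower-density , upper-density , permutable-avoiding
  where
  open Counting a b using (S)
  open Densities a b using (lower-density; upper-density)
  open Enumeration a b using (permutable-avoiding)
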